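{- Let $D=(G,\mathcal{O},w)$ be a weighted oriented graph and let $H$ be a $\star$-semi-forest of $D$, with associated sets $W_1,W_2$ and $\tilde H$ as in its definition. Then $V(H)\subseteq N_D(W_1)\cup N_D^{+}(W_2\cup\tilde H)$.
   Context: A weighted oriented graph is a triple $D=(G,\mathcal{O},w)$ with $G$ a finite simple graph, $\mathcal{O}$ an orientation of its edges, $w:V(G)\to\mathbb{N}$; $E(D)$ is the set of oriented edges. $V^{+}=\{x\mid w(x)>1\}$. $N_D^{+}(x)=\{y\mid(x,y)\in E(D)\}$, $N_D^{ - }(x)=\{y\mid(y,x)\in E(D)\}$, $N_D(x)=N_D^+(x)\cup N_D^-(x)$; for sets, unions over elements. Standing convention: every source has weight $1$. Weighted oriented subgraph: oriented subgraph of $(G,\mathcal{O})$ with restricted weights; $\deg_H(x)$ = number of neighbours of $x$ in $H$. Oriented path: distinct $(y_1,\dots,y_m)$ with $(y_i,y_{i+1})\in E(D)$; oriented cycle: such a path closed by $(y_m,y_1)\in E(D)$. Unicycle oriented subgraph: weighted oriented subgraph $B$ with exactly one cycle $C$, such that $C$ is an oriented cycle, every $y\in V(B)\setminus V(C)$ is reached by an oriented path in $B$ from a vertex of $C$, and $w(x)=1\Rightarrow\deg_B(x)=1$ for $x\in V(B)$. ROT with parent $v$: acyclic weighted oriented subgraph $T$ with $v\in V(T)$, every $x\ne v$ reached by an oriented path in $T$ from $v$, and $w(x)=1$ implies ($\deg_T(x)=1$ and $x\ne v$) or ($V(T)=\{v\}$ and $x=v$). A $\star$-semi-forest is $H=(\bigcup_{i=1}^r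 T_i)\cup(\bigcup_{j=1}^s B_j)$ with $T_i$ ROTs with parents $v_i$ and $B_j$ unicycle oriented subgraphs such that (i) $V(T_1),\dots,V(T_r),V(B_1),\dots,V(B_s)$ partition $V(H)$; (ii) there is $W=\{w_1,\dots,w_r\}\subseteq V(D)\setminus V(H)$ with $w_i\in N_D(v_i)$ (repetitions allowed); (iii) there is a partition $W_1,W_2$ of $W$ with $W_1$ stable in $G$, $W_2\subseteq V^+$, $(w_i,v_i)\in E(D)$ whenever $w_i\in W_2$, and $N_D^+(W_2\cup\tilde H)\cap W_1=\emptyset$, where $\tilde H=\{x\in V(H)\mid\deg_H(x)\ge2\}\cup\{v_i\mid\deg_H(v_i)=1\}$. -}

module Defs where

open import Data.Nat using (ℕ; zero; suc; _+_; _≤_; _<_)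
open import Data.Fin using (Fin; zero; suc)
open import Data.Bool using (Bool; true; false; _∨_; if_then_else_)
open import Data.List using (List; []; _∷_; length)
open import Data.List.Membership.Propositional using (_∈_)
open import Data.List.Relation.Unary.Unique.Propositional using (Unique)
open import Data.Product using (Σ; ∃; ∃-syntax; _×_; _,_)
open import Data.Sum using (_⊎_)
open import Relation.Binary.PropositionalEquality using (_≡_; _≢_)
open import Relation.Nullary using (¬_)
open import Function using (_∘_)

anyF : ∀ {k} → (Fin k → Bool) → Bool
anyF {zero} f = false
anyF {suc k} f = f zero ∨ anyF (f ∘ suc)

countF : ∀ {k} → (Fin k → Bool) → ℕ
countF {zero} f = 0
countF {suc k} f = (if f zero then 1 else 0) + countF (f ∘ suc)

data Walk {A : Set} (R : A → A → Set) : A → A → List A → Set where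
  here : ∀ {a} → Walk R a a (a ∷ [])
  step : ∀ {a b c vs} → R a b → Walk R b c vs → Walk R a c (a ∷ vs)

Path : {A : Set} → (A → A → Set) → A → A → Set
Path R a b = ∃[ vs ] (Walk R a b vs × Unique vs)

record ClosedSeq {A : Set} (R : A → A → Set) : Set where
  field
    first last : A
    verts      : List A
    walk       : Walk R first last verts
    distinct   : Unique verts
    closing    : R last first

cedgesAux : {A : Set} → A → List A → List (A × A)
cedgesAux y0 []           = []
cedgesAux y0 (x ∷ [])     = (x , y0) ∷ []
cedgesAux y0 (x ∷ y ∷ zs) = (x , y) ∷ cedgesAux y0 (y ∷ zs)

cedges : {A : Set} → List A → List (A × A)
cedges []       = []
cedges (x ∷ xs) = cedgesAux x (x ∷ xs)

CycEdge : {A : Set} → List A → A → A → Set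
CycEdge vs x y = ((x , y) ∈ cedges vs) ⊎ ((y , x) ∈ cedges vs)

record WOG (n : ℕ) : Set where
  field
    arc    : Fin n → Fin n → Bool
    -- G simple, O an orientation: no loops, no edge oriented both ways
    irrefl : ∀ x → arc x x ≡ false
    asym   : ∀ x y → arc x y ≡ true → arc y x ≡ false
    w      : Fin n → ℕ
    w-pos  : ∀ x → 1 ≤ w x
    -- standing convention: every source (N⁻(x) = ∅) has weight 1
    source-w1 : ∀ x → (∀ y → arc y x ≡ false) → w x ≡ 1

module _ {n : ℕ} (D : WOG n) where
  open WOG D

  Arc : Fin n → Fin n → Set
  Arc x y = arc x y ≡ true

  Adj : Fin n → Fin n → Set
  Adj x y = Arc x y ⊎ Arc y x

  VPlus : Fin n → Set
  VPlus x = 1 < w x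

  -- weighted oriented subgraph of D (weights are those of D restricted)
  record Sub : Set where
    field
      vs     : Fin n → Bool
      es     : Fin n → Fin n → Bool
      es⊆arc : ∀ x y → es x y ≡ true → Arc x y
      es-src : ∀ x y → es x y ≡ true → vs x ≡ true
      es-tgt : ∀ x y → es x y ≡ true → vs y ≡ true

  module _ (S : Sub) where
    open Sub S

    InS : Fin n → Set
    InS x = vs x ≡ true

    ArcS : Fin n → Fin n → Set
    ArcS x y = es x y ≡ true

    AdjS : Fin n → Fin n → Set
    AdjS x y = ArcS x y ⊎ ArcS y x

    degS : Fin n → ℕ
    degS x = countF (λ y → es x y ∨ es y x)

    record UCycle : Set where
      field
        cyc    : ClosedSeq AdjS
        len≥3  : 3 ≤ length (ClosedSeq.verts cyc)

    Acyclic : Set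
    Acyclic = ¬ UCycle

    OCycle : Set
    OCycle = ClosedSeq ArcS

    record IsROT (v : Fin n) : Set where
      field
        acyclic   : Acyclic
        v∈        : InS v
        reach     : ∀ x → InS x → x ≢ v → Path ArcS v x
        weight1   : ∀ x → InS x → w x ≡ 1 →
                      (degS x ≡ 1 × x ≢ v) ⊎ ((∀ y → InS y → y ≡ v) × x ≡ v)

    record IsUnicycle : Set where
      field
        C        : OCycle
        unique   : ∀ (C' : UCycle) → ∀ x y →
                     (CycEdge (ClosedSeq.verts (UCycle.cyc C')) x y
                       → CycEdge (ClosedSeq.verts C) x y)
                   × (CycEdge (ClosedSeq.verts C) x y
                       → CycEdge (ClosedSeq.verts (UCycle.cyc C')) x y)
        reach    : ∀ y → InS y → ¬ (y ∈ ClosedSeq.verts C) →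
                     ∃[ c ] (c ∈ ClosedSeq.verts C × Path ArcS c y)
        weight1  : ∀ x → InS x → w x ≡ 1 → degS x ≡ 1

  record StarSemiForest : Set₁ where
    field
      r s  : ℕ
      T    : Fin r → Sub
      v    : Fin r → Fin n
      B    : Fin s → Sub
      T-ROT : ∀ i → IsROT (T i) (v i)
      B-uni : ∀ j → IsUnicycle (B j)

    vH : Fin n → Bool
    vH x = anyF (λ i → Sub.vs (T i) x) ∨ anyF (λ j → Sub.vs (B j) x)

    eH : Fin n → Fin n → Bool
    eH x y = anyF (λ i → Sub.es (T i) x y) ∨ anyF (λ j → Sub.es (B j) x y)

    InH : Fin n → Set
    InH x = vH x ≡ true

    degH : Fin n → ℕ
    degH x = countF (λ y → eH x y ∨ eH y x)

    Htilde : Fin n → Set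
    Htilde x = InH x × (2 ≤ degH x ⊎ ∃[ i ] (x ≡ v i × degH x ≡ 1))

    field
      disjTT : ∀ i i' x → InS (T i) x → InS (T i') x → i ≡ i'
      disjBB : ∀ j j' x → InS (B j) x → InS (B j') x → j ≡ j'
      disjTB : ∀ i j x → InS (T i) x → ¬ InS (B j) x
      wv     : Fin r → Fin n
      wv∉H   : ∀ i → ¬ InH (wv i)
      wv-nbr : ∀ i → Adj (wv i) (v i)
      W₁ W₂  : Fin n → Set
      W-cover : ∀ i → W₁ (wv i) ⊎ W₂ (wv i)
      W-disj  : ∀ x → ¬ (W₁ x × W₂ x)
      W⊆W    : ∀ x → W₁ x ⊎ W₂ x → ∃[ i ] (wv i ≡ x)
      W₁-stable : ∀ x y → W₁ x → W₁ y → ¬ Adj x y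
      W₂⊆V⁺  : ∀ x → W₂ x → VPlus x
      W₂-arc : ∀ i → W₂ (wv i) → Arc (wv i) (v i)
      out∩W₁ : ∀ x y → (W₂ x ⊎ Htilde x) → Arc x y → ¬ W₁ y

{-# OPTIONS --safe #-}
-- Every vertex x of H either is a parent v_i, and then w_i lies in W₁ (so x ∈ N_D(W₁))
-- or in W₂ (so x ∈ N⁺_D(W₂)), or it is entered in H by an arc (y , x). In the latter
-- case y is itself entered in H by an arc from some z ≠ x, so deg_H y ≥ 2, unless y is
-- the parent of its tree; either way y ∈ H̃. Such arcs exist by following the oriented
-- path from the parent (in a ROT) or from the cycle (in a unicycle) to x.
module Submission where

open import Defs
open import Data.Nat using (ℕ; suc; _≤_; z≤n; s≤s)
open import Data.Nat.Properties using (m≤n⇒m<n∨m≡n)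
open import Data.Fin using (Fin; zero; suc; _≟_)
open import Data.Bool using (Bool; true; false; _∨_)
open import Data.List.Membership.Propositional using (_∈_)
open import Data.List.Relation.Unary.Any using (here; there; any?)
open import Data.List.Relation.Unary.All using (lookup)
open import Data.List.Relation.Unary.AllPairs using (_∷_)
open import Data.List.Relation.Unary.Unique.Propositional using (Unique)
open import Data.Product using (∃-syntax; _×_; _,_; proj₁; proj₂)
open import Data.Sum using (_⊎_; inj₁; inj₂; map₂)
open import Data.Empty using (⊥-elim)
open import Relation.Nullary using (yes; no)
open import Relation.Binary.PropositionalEquality using (_≡_; _≢_; refl; sym; trans; cong; subst)
open import Function using (_∘_)

∨-true⇒⊎ : ∀ {a b} → a ∨ b ≡ true → a ≡ true ⊎ b ≡ true
∨-true⇒⊎ {true}  _ = inj₁ refl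
∨-true⇒⊎ {false} p = inj₂ p

∨-trueˡ : ∀ {a b} → a ≡ true → a ∨ b ≡ true
∨-trueˡ refl = refl

∨-trueʳ : ∀ {a b} → b ≡ true → a ∨ b ≡ true
∨-trueʳ {true}  _ = refl
∨-trueʳ {false} p = p

anyF-true⇒∃ : ∀ {k} (f : Fin k → Bool) → anyF f ≡ true → ∃[ i ] (f i ≡ true)
anyF-true⇒∃ {suc k} f p with f zero in fzero
... | true  = zero , fzero
... | false with anyF-true⇒∃ (f ∘ suc) p
...   | i , fi = suc i , fi

∃⇒anyF-true : ∀ {k} (f : Fin k → Bool) i → f i ≡ true → anyF f ≡ true
∃⇒anyF-true f zero    fi rewrite fi = refl
∃⇒anyF-true f (suc i) fi with f zero
... | true  = refl
... | false = ∃⇒anyF-true (f ∘ suc) i fi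

1≤countF : ∀ {k} (f : Fin k → Bool) i → f i ≡ true → 1 ≤ countF f
1≤countF f zero    fi rewrite fi = s≤s z≤n
1≤countF f (suc i) fi with f zero
... | true  = s≤s z≤n
... | false = 1≤countF (f ∘ suc) i fi

2≤countF : ∀ {k} (f : Fin k → Bool) i j → f i ≡ true → f j ≡ true → i ≢ j → 2 ≤ countF f
2≤countF f zero    zero    _  _  i≢j = ⊥-elim (i≢j refl)
2≤countF f zero    (suc j) fi fj _   rewrite fi = s≤s (1≤countF (f ∘ suc) j fj)
2≤countF f (suc i) zero    fi fj _   rewrite fj = s≤s (1≤countF (f ∘ suc) i fi)
2≤countF f (suc i) (suc j) fi fj i≢j with f zero
... | true  = s≤s (1≤countF (f ∘ suc) i fi)
... | false = 2≤countF (f ∘ suc) i j fi fj (i≢j ∘ cong suc)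

module _ {A : Set} {R : A → A → Set} where

  walk-last∈ : ∀ {a c vs} → Walk R a c vs → c ∈ vs
  walk-last∈ here       = here refl
  walk-last∈ (step _ w) = there (walk-last∈ w)

  walk-pred : ∀ {a b c vs} → Walk R a b vs → c ∈ vs → c ≡ a ⊎ ∃[ p ] (p ∈ vs × R p c)
  walk-pred here       (here refl) = inj₁ refl
  walk-pred (step _ _) (here refl) = inj₁ refl
  walk-pred {a = a} (step r w) (there c∈) with walk-pred w c∈
  ... | inj₁ refl           = inj₂ (a , here refl , r)
  ... | inj₂ (p , p∈ , rpc) = inj₂ (p , there p∈ , rpc)

  closedSeq-pred : (C : ClosedSeq R) → ∀ {c} → c ∈ ClosedSeq.verts C →
                   ∃[ p ] (p ∈ ClosedSeq.verts C × R p c)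
  closedSeq-pred C c∈ with walk-pred (ClosedSeq.walk C) c∈
  ... | inj₁ refl = ClosedSeq.last C , walk-last∈ (ClosedSeq.walk C) , ClosedSeq.closing C
  ... | inj₂ pred = pred

  -- z ≢ c holds because the vertices of a path are distinct.
  path-lastArcs : ∀ {a c vs} → Walk R a c vs → Unique vs → a ≢ c →
                  ∃[ y ] (R y c × (y ≡ a ⊎ ∃[ z ] (R z y × z ≢ c)))
  path-lastArcs here _ a≢c = ⊥-elim (a≢c refl)
  path-lastArcs {a = a} (step r here) _ _ = a , r , inj₁ refl
  path-lastArcs {a = a} (step r (step {b = b} r′ w)) (_ ∷ b∉ ∷ u) a≢c
    with path-lastArcs (step r′ w) (b∉ ∷ u)
           (λ b≡c → lookup b∉ (subst (_∈ _) (sym b≡c) (walk-last∈ w)) refl)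
  ... | y , ryc , inj₁ refl = y , ryc , inj₂ (a , r , a≢c)
  ... | y , ryc , inj₂ prev = y , ryc , inj₂ prev

arc-arc⇒≢ : ∀ {n} (D : WOG n) {x y z} → Arc D z y → Arc D y x → z ≢ x
arc-arc⇒≢ D z→y y→x refl with trans (sym y→x) (WOG.asym D _ _ z→y)
... | ()

module _ {n : ℕ} {D : WOG n} (H : StarSemiForest D) where
  open WOG D
  open StarSemiForest H

  Covered : Fin n → Set
  Covered x = (∃[ y ] (W₁ y × Adj D y x)) ⊎ (∃[ y ] ((W₂ y ⊎ Htilde y) × Arc D y x))

  T⊆H : ∀ i {x} → InS D (T i) x → InH x
  T⊆H i {x} x∈ = ∨-trueˡ (∃⇒anyF-true (λ i → Sub.vs (T i) x) i x∈)

  B⊆H : ∀ j {x} → InS D (B j) x → InH x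
  B⊆H j {x} x∈ = ∨-trueʳ (∃⇒anyF-true (λ j → Sub.vs (B j) x) j x∈)

  arcT⇒eH : ∀ i {x y} → ArcS D (T i) x y → eH x y ≡ true
  arcT⇒eH i {x} {y} e = ∨-trueˡ (∃⇒anyF-true (λ i → Sub.es (T i) x y) i e)

  arcB⇒eH : ∀ j {x y} → ArcS D (B j) x y → eH x y ≡ true
  arcB⇒eH j {x} {y} e = ∨-trueʳ (∃⇒anyF-true (λ j → Sub.es (B j) x y) j e)

  eH⇒arc×InH : ∀ {x y} → eH x y ≡ true → Arc D x y × InH x
  eH⇒arc×InH {x} {y} e with ∨-true⇒⊎ e
  ... | inj₁ eT with anyF-true⇒∃ _ eT
  ...   | i , e′ = Sub.es⊆arc (T i) x y e′ , T⊆H i (Sub.es-src (T i) x y e′)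
  eH⇒arc×InH {x} {y} e | inj₂ eB with anyF-true⇒∃ _ eB
  ...   | j , e′ = Sub.es⊆arc (B j) x y e′ , B⊆H j (Sub.es-src (B j) x y e′)

  Htilde-inOut : ∀ {x y z} → eH z y ≡ true → eH y x ≡ true → z ≢ x → Htilde y
  Htilde-inOut {x} {y} {z} z→y y→x z≢x =
    proj₂ (eH⇒arc×InH y→x) , inj₁ (2≤countF (λ u → eH y u ∨ eH u y) z x (∨-trueʳ {eH y z} z→y) (∨-trueˡ y→x) z≢x)

  Htilde-parent : ∀ i {x} → eH (v i) x ≡ true → Htilde (v i)
  Htilde-parent i {x} v→x =
    proj₂ (eH⇒arc×InH v→x) ,
    map₂ (λ 1≡deg → i , refl , sym 1≡deg)
         (m≤n⇒m<n∨m≡n (1≤countF (λ u → eH (v i) u ∨ eH u (v i)) x (∨-trueˡ v→x)))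

  covered-parent : ∀ i → Covered (v i)
  covered-parent i with W-cover i
  ... | inj₁ w∈W₁ = inj₁ (wv i , w∈W₁ , wv-nbr i)
  ... | inj₂ w∈W₂ = inj₂ (wv i , inj₁ w∈W₂ , W₂-arc i w∈W₂)

  covered-Htilde-out : ∀ {x y} → Htilde y → eH y x ≡ true → Covered x
  covered-Htilde-out {y = y} y∈H̃ y→x = inj₂ (y , inj₂ y∈H̃ , proj₁ (eH⇒arc×InH y→x))

  covered-twoArcs : ∀ {x y z} → eH z y ≡ true → eH y x ≡ true → z ≢ x → Covered x
  covered-twoArcs z→y y→x z≢x = covered-Htilde-out (Htilde-inOut z→y y→x z≢x) y→x

  covered-T : ∀ i {x} → InS D (T i) x → Covered x
  covered-T i {x} x∈T with x ≟ v i
  ... | yes refl = covered-parent i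
  ... | no x≢v with IsROT.reach (T-ROT i) x x∈T x≢v
  ... | _ , walk , distinct with path-lastArcs walk distinct (x≢v ∘ sym)
  ... | y , y→x , inj₁ refl =
    covered-Htilde-out (Htilde-parent i (arcT⇒eH i y→x)) (arcT⇒eH i y→x)
  ... | y , y→x , inj₂ (z , z→y , z≢x) =
    covered-twoArcs (arcT⇒eH i z→y) (arcT⇒eH i y→x) z≢x

  covered-B : ∀ j {x} → InS D (B j) x → Covered x
  covered-B j {x} x∈B with any? (x ≟_) (ClosedSeq.verts (IsUnicycle.C (B-uni j)))
  ... | yes x∈C with closedSeq-pred (IsUnicycle.C (B-uni j)) x∈C
  ... | y , y∈C , y→x with closedSeq-pred (IsUnicycle.C (B-uni j)) y∈C
  ... | z , _ , z→y = covered-twoArcs (arcB⇒eH j z→y) (arcB⇒eH j y→x)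
                        (arc-arc⇒≢ D (Sub.es⊆arc (B j) _ _ z→y) (Sub.es⊆arc (B j) _ _ y→x))
  covered-B j {x} x∈B | no x∉C with IsUnicycle.reach (B-uni j) x x∈B x∉C
  ... | c , c∈C , _ , walk , distinct with path-lastArcs walk distinct (λ { refl → x∉C c∈C })
  ... | y , y→x , inj₁ refl with closedSeq-pred (IsUnicycle.C (B-uni j)) c∈C
  ... | p , p∈C , p→y = covered-twoArcs (arcB⇒eH j p→y) (arcB⇒eH j y→x) (λ { refl → x∉C p∈C })
  covered-B j {x} x∈B | no x∉C | c , c∈C , _ , walk , distinct | y , y→x , inj₂ (z , z→y , z≢x) =
    covered-twoArcs (arcB⇒eH j z→y) (arcB⇒eH j y→x) z≢x

lemma3p6 : ∀ {n : ℕ} (D : WOG n) (H : StarSemiForest D) →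
             ∀ x → StarSemiForest.InH H x →
             (∃[ y ] (StarSemiForest.W₁ H y × Adj D y x))
             ⊎ (∃[ y ] ((StarSemiForest.W₂ H y ⊎ StarSemiForest.Htilde H y) × Arc D y x))
lemma3p6 D H x x∈H with ∨-true⇒⊎ x∈H
... | inj₁ x∈⋃T with anyF-true⇒∃ _ x∈⋃T
...   | i , x∈T = covered-T H i x∈T
lemma3p6 D H x x∈H | inj₂ x∈⋃B with anyF-true⇒∃ _ x∈⋃B
...   | j , x∈B = covered-B H j x∈B
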